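{- For all positive integers $m$ and $n$, $$\sum_{i=0}^{n}\sum_{j=0}^{m}\binom{n}{i}\binom{m}{j}\binom{i+j}{n}=\binom{n+m}{n}2^m.$$
   Context: Binomial coefficients $\binom{a}{b}$ are taken to be $0$ when $b>a$ or $b<0$ (for nonnegative integers $a$). -}

module Defs where

open import Data.Nat using (ℕ; zero; suc; _+_)

sumTo : ℕ → (ℕ → ℕ) → ℕ
sumTo zero    f = f 0
sumTo (suc n) f = sumTo n f + f (suc n)

-- Write E for the shift g ↦ g ∘ suc on functions ℕ → ℕ. The inner sum Σⱼ C(m,j) f(i+j) is
-- ((1 + E)ᵐ f)(i), so the double sum is ((1 + E)ⁿ (1 + E)ᵐ f)(0) = ((1 + E)ⁿ⁺ᵐ f)(0) with
-- f k = C(k,n), that is Σₖ C(n+m,k) C(k,n). This counts the pairs B ⊆ A ⊆ {1,…,n+m} with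
-- |B| = n, hence equals C(n+m,n) 2ᵐ (choose B, then any A between B and the whole set).
module Submission where

open import Defs
open import Data.Nat using (ℕ; zero; suc; _+_; _*_; _^_; _≤_; _<_; s≤s)
open import Data.Nat.Properties
  using (+-assoc; +-identityʳ; *-identityˡ; +-suc; *-assoc; *-distribˡ-+; *-distribʳ-+; n<1+n; m<n⇒m<1+n;
         +-commutativeSemigroup)
open import Data.Nat.Combinatorics using (_C_; k>n⇒nCk≡0; nCk+nC[k+1]≡[n+1]C[k+1]; nCn≡1)
open import Data.Nat.Tactic.RingSolver using (solve-∀)
open import Algebra.Properties.CommutativeSemigroup +-commutativeSemigroup
  using (interchange; x∙yz≈xz∙y)
open import Relation.Binary.PropositionalEquality
  using (_≡_; refl; sym; trans; cong; cong₂; module ≡-Reasoning)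
open ≡-Reasoning

sumTo-cong : ∀ n {f g : ℕ → ℕ} → (∀ k → f k ≡ g k) → sumTo n f ≡ sumTo n g
sumTo-cong zero    f≡g = f≡g 0
sumTo-cong (suc n) f≡g = cong₂ _+_ (sumTo-cong n f≡g) (f≡g (suc n))

sumTo-+ : ∀ n (f g : ℕ → ℕ) → sumTo n (λ k → f k + g k) ≡ sumTo n f + sumTo n g
sumTo-+ zero    f g = refl
sumTo-+ (suc n) f g = trans (cong (_+ (f (suc n) + g (suc n))) (sumTo-+ n f g))
  (interchange (sumTo n f) (sumTo n g) (f (suc n)) (g (suc n)))

sumTo-*ˡ : ∀ n c (f : ℕ → ℕ) → sumTo n (λ k → c * f k) ≡ c * sumTo n f
sumTo-*ˡ zero    c f = refl
sumTo-*ˡ (suc n) c f = trans (cong (_+ c * f (suc n)) (sumTo-*ˡ n c f))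
  (sym (*-distribˡ-+ c (sumTo n f) (f (suc n))))

sumTo-suc-head : ∀ n (f : ℕ → ℕ) → sumTo (suc n) f ≡ f 0 + sumTo n (λ k → f (suc k))
sumTo-suc-head zero    f = refl
sumTo-suc-head (suc n) f = trans (cong (_+ f (suc (suc n))) (sumTo-suc-head n f))
  (+-assoc (f 0) _ _)

-- ((1 + E)ᵐ g)(i), where E g = g ∘ suc.
binomialShift : ℕ → (ℕ → ℕ) → ℕ → ℕ
binomialShift m g i = sumTo m (λ j → (m C j) * g (i + j))

binomialShift-cong : ∀ m {f g : ℕ → ℕ} i → (∀ k → f k ≡ g k) →
                     binomialShift m f i ≡ binomialShift m g i
binomialShift-cong m i f≡g = sumTo-cong m (λ j → cong ((m C j) *_) (f≡g (i + j)))

binomialShift-+ : ∀ m (f g : ℕ → ℕ) i →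
                  binomialShift m (λ k → f k + g k) i ≡ binomialShift m f i + binomialShift m g i
binomialShift-+ m f g i =
  trans (sumTo-cong m (λ j → *-distribˡ-+ (m C j) (f (i + j)) (g (i + j)))) (sumTo-+ m _ _)

binomialShift-*ˡ : ∀ m c (f : ℕ → ℕ) i → binomialShift m (λ k → c * f k) i ≡ c * binomialShift m f i
binomialShift-*ˡ m c f i =
  trans (sumTo-cong m (λ j → x*[c*y]≡c*[x*y] c (m C j) (f (i + j)))) (sumTo-*ˡ m c _)
  where
  x*[c*y]≡c*[x*y] : ∀ c x y → x * (c * y) ≡ c * (x * y)
  x*[c*y]≡c*[x*y] = solve-∀

binomialShift-head : ∀ m g i →
  binomialShift m g i ≡ (m C 0) * g (i + 0) + sumTo m (λ j → (m C suc j) * g (i + suc j))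
binomialShift-head m g i = begin
  binomialShift m g i
    ≡⟨ sym (+-identityʳ _) ⟩
  binomialShift m g i + 0
    ≡⟨ cong (λ c → binomialShift m g i + c * g (i + suc m)) (sym (k>n⇒nCk≡0 (n<1+n m))) ⟩
  sumTo (suc m) (λ j → (m C j) * g (i + j))
    ≡⟨ sumTo-suc-head m _ ⟩
  (m C 0) * g (i + 0) + sumTo m (λ j → (m C suc j) * g (i + suc j)) ∎

binomialShift-suc : ∀ m g i →
  binomialShift (suc m) g i ≡ binomialShift m g i + binomialShift m g (suc i)
binomialShift-suc m g i = begin
  binomialShift (suc m) g i
    ≡⟨ sumTo-suc-head m _ ⟩
  head + sumTo m (λ j → (suc m C suc j) * g (i + suc j))
    ≡⟨ cong (head +_) (trans (sumTo-cong m pascal) (sumTo-+ m lower upper)) ⟩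
  head + (sumTo m lower + sumTo m upper)
    ≡⟨ x∙yz≈xz∙y head _ _ ⟩
  (head + sumTo m upper) + sumTo m lower
    ≡⟨ cong₂ _+_ (sym (binomialShift-head m g i))
                 (sumTo-cong m (λ j → cong (λ k → (m C j) * g k) (+-suc i j))) ⟩
  binomialShift m g i + binomialShift m g (suc i) ∎
  where
  head = (m C 0) * g (i + 0)
  lower upper : ℕ → ℕ
  lower j = (m C j) * g (i + suc j)
  upper j = (m C suc j) * g (i + suc j)
  pascal : ∀ j → (suc m C suc j) * g (i + suc j) ≡ lower j + upper j
  pascal j = trans (cong (_* g (i + suc j)) (sym (nCk+nC[k+1]≡[n+1]C[k+1] m j)))
                   (*-distribʳ-+ (g (i + suc j)) (m C j) (m C suc j))

binomialShift-suc-inner : ∀ m g i →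
  binomialShift (suc m) g i ≡ binomialShift m (λ k → g k + g (suc k)) i
binomialShift-suc-inner m g i =
  trans (binomialShift-suc m g i) (sym (binomialShift-+ m g (λ k → g (suc k)) i))

binomialShift-+-exponent : ∀ a b g i →
  binomialShift (a + b) g i ≡ binomialShift a (binomialShift b g) i
binomialShift-+-exponent zero    b g i =
  trans (cong (binomialShift b g) (sym (+-identityʳ i))) (sym (*-identityˡ _))
binomialShift-+-exponent (suc a) b g i = begin
  binomialShift (suc (a + b)) g i
    ≡⟨ binomialShift-suc (a + b) g i ⟩
  binomialShift (a + b) g i + binomialShift (a + b) g (suc i)
    ≡⟨ cong₂ _+_ (binomialShift-+-exponent a b g i) (binomialShift-+-exponent a b g (suc i)) ⟩
  binomialShift a (binomialShift b g) i + binomialShift a (binomialShift b g) (suc i)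
    ≡⟨ sym (binomialShift-suc a (binomialShift b g) i) ⟩
  binomialShift (suc a) (binomialShift b g) i ∎

-- Σₖ C(M,k) C(k,N): the number of pairs B ⊆ A ⊆ {1,…,M} with |B| = N.
subsetPairs : ℕ → ℕ → ℕ
subsetPairs M N = binomialShift M (_C N) 0

subsetPairs-suc-zero : ∀ M → subsetPairs (suc M) 0 ≡ 2 * subsetPairs M 0
subsetPairs-suc-zero M =
  trans (binomialShift-suc-inner M (_C 0) 0) (binomialShift-*ˡ M 2 (_C 0) 0)

subsetPairs-suc-suc : ∀ M N →
  subsetPairs (suc M) (suc N) ≡ 2 * subsetPairs M (suc N) + subsetPairs M N
subsetPairs-suc-suc M N = begin
  subsetPairs (suc M) (suc N)
    ≡⟨ binomialShift-suc-inner M (_C suc N) 0 ⟩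
  binomialShift M (λ k → k C suc N + suc k C suc N) 0
    ≡⟨ binomialShift-cong M 0 pascal ⟩
  binomialShift M (λ k → 2 * (k C suc N) + k C N) 0
    ≡⟨ binomialShift-+ M _ _ 0 ⟩
  binomialShift M (λ k → 2 * (k C suc N)) 0 + subsetPairs M N
    ≡⟨ cong (_+ subsetPairs M N) (binomialShift-*ˡ M 2 (_C suc N) 0) ⟩
  2 * subsetPairs M (suc N) + subsetPairs M N ∎
  where
  a+[b+a]≡2*a+b : ∀ a b → a + (b + a) ≡ 2 * a + b
  a+[b+a]≡2*a+b = solve-∀
  pascal : ∀ k → k C suc N + suc k C suc N ≡ 2 * (k C suc N) + k C N
  pascal k = trans (cong (k C suc N +_) (sym (nCk+nC[k+1]≡[n+1]C[k+1] k N)))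
                   (a+[b+a]≡2*a+b (k C suc N) (k C N))

subsetPairs-< : ∀ {M N} → M < N → subsetPairs M N ≡ 0
subsetPairs-< {zero}  {suc N} _         = refl
subsetPairs-< {suc M} {suc N} (s≤s M<N) = begin
  subsetPairs (suc M) (suc N)
    ≡⟨ subsetPairs-suc-suc M N ⟩
  2 * subsetPairs M (suc N) + subsetPairs M N
    ≡⟨ cong₂ (λ a b → 2 * a + b) (subsetPairs-< (m<n⇒m<1+n M<N)) (subsetPairs-< M<N) ⟩
  0 ∎

subsetPairs-diagonal : ∀ N → subsetPairs N N ≡ 1
subsetPairs-diagonal zero    = refl
subsetPairs-diagonal (suc N) = trans (subsetPairs-suc-suc N N)
  (cong₂ (λ a b → 2 * a + b) (subsetPairs-< (n<1+n N)) (subsetPairs-diagonal N))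

subsetPairs-closedForm : ∀ N m → subsetPairs (N + m) N ≡ ((N + m) C N) * 2 ^ m
subsetPairs-closedForm N       zero    rewrite +-identityʳ N =
  trans (subsetPairs-diagonal N) (cong (_* 1) (sym (nCn≡1 N)))
subsetPairs-closedForm zero    (suc m) = begin
  subsetPairs (suc m) 0              ≡⟨ subsetPairs-suc-zero m ⟩
  2 * subsetPairs m 0                ≡⟨ cong (2 *_) (trans (subsetPairs-closedForm zero m) (*-identityˡ _)) ⟩
  2 * 2 ^ m                          ≡⟨ sym (*-identityˡ _) ⟩
  (suc m C 0) * 2 ^ suc m            ∎
subsetPairs-closedForm (suc N) (suc m) = begin
  subsetPairs (suc K) (suc N)
    ≡⟨ subsetPairs-suc-suc K N ⟩
  2 * subsetPairs K (suc N) + subsetPairs K N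
    ≡⟨ cong₂ (λ a b → 2 * a + b) previousColumn (subsetPairs-closedForm N (suc m)) ⟩
  2 * ((K C suc N) * 2 ^ m) + (K C N) * (2 * 2 ^ m)
    ≡⟨ 2*[a*p]+b*[2*p]≡[b+a]*[2*p] (K C suc N) (K C N) (2 ^ m) ⟩
  (K C N + K C suc N) * (2 * 2 ^ m)
    ≡⟨ cong (_* 2 ^ suc m) (nCk+nC[k+1]≡[n+1]C[k+1] K N) ⟩
  (suc K C suc N) * 2 ^ suc m ∎
  where
  K = N + suc m
  previousColumn : subsetPairs K (suc N) ≡ (K C suc N) * 2 ^ m
  previousColumn rewrite +-suc N m = subsetPairs-closedForm (suc N) m
  2*[a*p]+b*[2*p]≡[b+a]*[2*p] : ∀ a b p → 2 * (a * p) + b * (2 * p) ≡ (b + a) * (2 * p)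
  2*[a*p]+b*[2*p]≡[b+a]*[2*p] = solve-∀

mainTheorem5 : (m n : ℕ) → 1 ≤ m → 1 ≤ n →
    sumTo n (λ i → sumTo m (λ j → (n C i) * (m C j) * ((i + j) C n)))
    ≡ ((n + m) C n) * 2 ^ m
mainTheorem5 m n _ _ = begin
  sumTo n (λ i → sumTo m (λ j → (n C i) * (m C j) * ((i + j) C n)))
    ≡⟨ sumTo-cong n (λ i → trans (sumTo-cong m (λ j → *-assoc (n C i) (m C j) ((i + j) C n)))
                                  (sumTo-*ˡ m (n C i) _)) ⟩
  binomialShift n (binomialShift m (_C n)) 0
    ≡⟨ sym (binomialShift-+-exponent n m (_C n) 0) ⟩
  subsetPairs (n + m) n
    ≡⟨ subsetPairs-closedForm n m ⟩
  ((n + m) C n) * 2 ^ m ∎
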